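{- Let $t$ be a positive integer and write $t=9q+r$ with $q=\lfloor t/9\rfloor$ and $0\le r\le 8$. Then \[\pi_t^*(K_2\Box K_2)=\begin{cases}3 & \text{if } t=1,\\ 16q+2r & \text{if } r\in\{0,1,2,3,4,5\}\text{ and } t\ne 1,\\ 16q+2r-1 & \text{if } r\in\{6,7,8\}.\end{cases}\] Moreover, for every $t\ne 1$, $\pi_t^*(K_2\Box K_2)=\left\lceil \frac{2}{3}\pi^*_{2t}(K_2)\right\rceil$.
   Context: A distribution on a graph $G=(V,E)$ is a function $D:V\to\mathbb{N}$, with size $|D|=\sum_v D(v)$. A pebbling move removes two pebbles from a vertex having at least two pebbles and places one pebble on a neighbor. A distribution $D$ is $t$-solvable if for every vertex $v$, some sequence of pebbling moves starting from $D$ results in a distribution with at least $t$ pebbles on $v$. The optimal $t$-pebbling number $\pi_t^*(G)$ is the minimum size of a $t$-solvable distribution on $G$. $K_2$ is the complete graph on two vertices and $\Box$ is the Cartesian product of graphs (so $K_2\Box K_2$ is the 4-cycle). -}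

module Defs where

open import Data.Nat using (ℕ; _+_; _≤_)
open import Data.Fin using (Fin)
open import Data.List using (List; map; allFin; cartesianProduct)
open import Data.Nat.ListAction using (sum)
open import Data.Product using (Σ; ∃; _×_; _,_)
open import Data.Sum using (_⊎_)
open import Relation.Nullary using (¬_)
open import Relation.Binary.PropositionalEquality using (_≡_; _≢_)
open import Relation.Binary.Construct.Closure.ReflexiveTransitive using (Star)

-- A finite graph: a vertex type, an enumeration of its vertices
-- (each vertex listed exactly once), and an adjacency relation.
record Graph : Set₁ where
  field
    V        : Set
    vertices : List V
    Adj      : V → V → Set
open Graph public

Distribution : Graph → Set
Distribution G = V G → ℕ

size : (G : Graph) → Distribution G → ℕ
size G D = sum (map D (vertices G))

Move : (G : Graph) → Distribution G → Distribution G → Set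
Move G D D' = Σ (V G) λ u → Σ (V G) λ v →
  Adj G u v × u ≢ v × 2 ≤ D u ×
  (D' u + 2 ≡ D u) × (D' v ≡ D v + 1) ×
  (∀ w → w ≢ u → w ≢ v → D' w ≡ D w)

Reach : (G : Graph) → Distribution G → Distribution G → Set
Reach G = Star (Move G)

Solvable : (G : Graph) → ℕ → Distribution G → Set
Solvable G t D = ∀ (v : V G) → ∃ λ D' → Reach G D D' × t ≤ D' v

IsOptimalPebbling : (G : Graph) → ℕ → ℕ → Set
IsOptimalPebbling G t k =
  (∃ λ D → Solvable G t D × size G D ≡ k) ×
  (∀ D → Solvable G t D → k ≤ size G D)

K₂ : Graph
K₂ = record { V = Fin 2 ; vertices = allFin 2 ; Adj = λ x y → x ≢ y }

_□_ : Graph → Graph → Graph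
G □ H = record
  { V = V G × V H
  ; vertices = cartesianProduct (vertices G) (vertices H)
  ; Adj = λ { (a , b) (c , d) → (Adj G a c × b ≡ d) ⊎ (a ≡ c × Adj H b d) }
  }

-- Weighting a pebble by 2 on p, by 1 on the
-- neighbours of p and by 1/2 (rounded down) on the vertex opposite p gives a potential that no
-- pebbling move increases and that is at least twice the number of pebbles p can receive. The four
-- potentials of a distribution of size n add up to (9n − #odd piles)/2, so t-solvability forces
-- 16t ≤ 9n. If t ≡ 5 (mod 9) and n = ⌈16t/9⌉, all four potentials must equal 2t; comparing
-- opposite potentials modulo 3 shows opposite piles have equal parity, so 9n = 16t + 2k with
-- k ≤ 2, impossible modulo 9. For t = 1, at most two pebbles force every pile to be at most 1, so
-- no move is possible and every vertex needs a pebble of its own. Matching distributions are bases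
-- for t ≤ 10, solved by spreading the opposite pile onto the neighbours and gathering everything at
-- the target; adding four pebbles to every vertex raises t by nine. On K₂ the potential
-- 2D(v) + D(w) gives π*ₙ(K₂) = ⌈4n/3⌉, and the last claim is then arithmetic.
module Submission where

open import Defs
open import Data.Nat
  using (ℕ; zero; suc; _+_; _*_; _∸_; _≤_; _<_; _/_; _%_; _⊔_; _⊓_; _≤ᵇ_; z≤n; s≤s; NonZero)
open import Data.Nat.Properties
open import Data.Nat.DivMod
  using (m≡m%n+[m/n]*n; m%n<n; [m+kn]%n≡m%n; m*n%n≡0; m<n⇒m%n≡m; +-distrib-/-∣ʳ; m*n/n≡m; m<n*o⇒m/o<n; /-monoˡ-≤)
open import Data.Nat.Divisibility using (divides)
open import Data.Nat.Tactic.RingSolver using (solve-∀; solve)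
open import Data.Fin using (zero; suc)
open import Data.List using (_∷_; [])
open import Data.Product using (∃; ∃₂; _×_; _,_; proj₁)
open import Data.Sum using (inj₁; inj₂)
open import Data.Empty using (⊥-elim)
open import Data.Bool using (T)
open import Relation.Nullary using (contradiction)
open import Relation.Binary.PropositionalEquality
open import Relation.Binary.Construct.Closure.ReflexiveTransitive using (Star; ε; _◅_; _◅◅_; gmap; fold)


≤-compute : ∀ {m n} {_ : T (m ≤ᵇ n)} → m ≤ n
≤-compute {m} {n} {m≤ᵇn} = ≤ᵇ⇒≤ m n m≤ᵇn

[m+kn]/n≡m/n+k : ∀ m k n .{{_ : NonZero n}} → (m + k * n) / n ≡ m / n + k
[m+kn]/n≡m/n+k m k n = trans (+-distrib-/-∣ʳ m (divides k refl)) (cong (m / n +_) (m*n/n≡m k n))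

m≤[1+d]*n⇒[m+d]/[1+d]≤n : ∀ {m n} d → m ≤ suc d * n → (m + d) / suc d ≤ n
m≤[1+d]*n⇒[m+d]/[1+d]≤n {m} {n} d m≤ =
  ≤-pred (m<n*o⇒m/o<n (≤-trans (s≤s (+-monoˡ-≤ d m≤)) (≤-reflexive (rearrange d n))))
  where
  rearrange : ∀ d n → suc (suc d * n + d) ≡ suc n * suc d
  rearrange = solve-∀

remainder-unique : ∀ {m m′ k k′ n} .{{_ : NonZero n}} → m < n → m′ < n →
              m + k * n ≡ m′ + k′ * n → m ≡ m′
remainder-unique {m} {m′} {k} {k′} {n} m<n m′<n eq = begin
  m                ≡⟨ m<n⇒m%n≡m m<n ⟨
  m % n            ≡⟨ [m+kn]%n≡m%n m k n ⟨
  (m + k * n) % n  ≡⟨ cong (_% n) eq ⟩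
  (m′ + k′ * n) % n ≡⟨ [m+kn]%n≡m%n m′ k′ n ⟩
  m′ % n           ≡⟨ m<n⇒m%n≡m m′<n ⟩
  m′               ∎
  where open ≡-Reasoning

squeeze : ∀ {m x y} → m ≤ x → m ≤ y → x + y ≤ m + m → x ≡ m × y ≡ m
squeeze {m} {x} {y} m≤x m≤y x+y≤ =
  ≤-antisym (+-cancelʳ-≤ y x m (≤-trans x+y≤ (+-monoʳ-≤ m m≤y))) m≤x ,
  ≤-antisym (+-cancelˡ-≤ x y m (≤-trans x+y≤ (+-monoˡ-≤ m m≤x))) m≤y

2*m≤2*n+1⇒m≤n : ∀ {m n} → 2 * m ≤ 2 * n + 1 → m ≤ n
2*m≤2*n+1⇒m≤n {m} {n} le =
  ≤-pred (*-cancelˡ-< 2 m (suc n) (≤-trans (s≤s le) (≤-reflexive (rearrange n))))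
  where
  rearrange : ∀ n → suc (2 * n + 1) ≡ 2 * suc n
  rearrange = solve-∀

Star-antitone : ∀ {A : Set} {R : A → A → Set} (f : A → ℕ) →
                (∀ {x y} → R x y → f y ≤ f x) → ∀ {x y} → Star R x y → f y ≤ f x
Star-antitone f antitone = fold (λ x y → f y ≤ f x) (λ r le → ≤-trans le (antitone r)) ≤-refl

-- F m n places m pebbles on the tail and n on the head of a fixed edge.
transfer : ∀ {A : Set} {R : A → A → Set} (F : ℕ → ℕ → A) →
           (∀ m n → R (F (2 + m) n) (F m (1 + n))) →
           ∀ k m n → Star R (F (k * 2 + m) n) (F m (n + k))
transfer {R = R} F pass zero    m n = subst (λ z → Star R (F m n) (F m z)) (sym (+-identityʳ n)) ε
transfer {R = R} F pass (suc k) m n =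
  pass (k * 2 + m) n ◅
  subst (λ z → Star R (F (k * 2 + m) (1 + n)) (F m z)) (sym (+-suc n k)) (transfer F pass k m (1 + n))

gather : ∀ {A : Set} {R : A → A → Set} (F : ℕ → ℕ → A) →
         (∀ m n → R (F (2 + m) n) (F m (1 + n))) →
         ∀ m n → Star R (F m n) (F (m % 2) (n + m / 2))
gather {R = R} F pass m n = subst (λ z → Star R (F z n) (F (m % 2) (n + m / 2))) halves (transfer F pass (m / 2) (m % 2) n)
  where
  halves : m / 2 * 2 + m % 2 ≡ m
  halves = trans (+-comm (m / 2 * 2) (m % 2)) (sym (m≡m%n+[m/n]*n m 2))

sparse-Reach⇒≡ : ∀ {G D D′} → (∀ v → D v ≤ 1) → Reach G D D′ → D′ ≡ D
sparse-Reach⇒≡ sparse ε = refl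
sparse-Reach⇒≡ sparse ((u , _ , _ , _ , 2≤Du , _) ◅ _) = contradiction 2≤Du (≤⇒≯ (sparse u))

-- K₂ □ K₂ as quadruples of pile sizes

C₄ : Graph
C₄ = K₂ □ K₂

-- p₀ p₁ p₂ p₃ run around the 4-cycle; a Quad lists their piles in this order.
p₀ p₁ p₂ p₃ : V C₄
p₀ = zero , zero
p₁ = zero , suc zero
p₂ = suc zero , suc zero
p₃ = suc zero , zero

Quad : Set
Quad = ℕ × ℕ × ℕ × ℕ

toQuad : Distribution C₄ → Quad
toQuad D = D p₀ , D p₁ , D p₂ , D p₃

fromQuad : Quad → Distribution C₄
fromQuad (a , b , c , d) (zero     , zero)     = a
fromQuad (a , b , c , d) (zero     , suc zero) = b
fromQuad (a , b , c , d) (suc zero , suc zero) = c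
fromQuad (a , b , c , d) (suc zero , zero)     = d

total : Quad → ℕ
total (a , b , c , d) = a + b + c + d

size≡total : ∀ D → size C₄ D ≡ total (toQuad D)
size≡total D = rearrange (D p₀) (D p₁) (D p₂) (D p₃)
  where
  rearrange : ∀ a b c d → a + (b + (d + (c + 0))) ≡ a + b + c + d
  rearrange = solve-∀

rotate : Quad → Quad
rotate (a , b , c , d) = b , c , d , a

variable
  a b c d a′ b′ c′ d′ : ℕ

data Step : Quad → Quad → Set where
  move₀₁ : a′ + 2 ≡ a → b′ ≡ b + 1 → c′ ≡ c → d′ ≡ d → Step (a , b , c , d) (a′ , b′ , c′ , d′)
  move₀₃ : a′ + 2 ≡ a → b′ ≡ b → c′ ≡ c → d′ ≡ d + 1 → Step (a , b , c , d) (a′ , b′ , c′ , d′)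
  move₁₀ : a′ ≡ a + 1 → b′ + 2 ≡ b → c′ ≡ c → d′ ≡ d → Step (a , b , c , d) (a′ , b′ , c′ , d′)
  move₁₂ : a′ ≡ a → b′ + 2 ≡ b → c′ ≡ c + 1 → d′ ≡ d → Step (a , b , c , d) (a′ , b′ , c′ , d′)
  move₂₁ : a′ ≡ a → b′ ≡ b + 1 → c′ + 2 ≡ c → d′ ≡ d → Step (a , b , c , d) (a′ , b′ , c′ , d′)
  move₂₃ : a′ ≡ a → b′ ≡ b → c′ + 2 ≡ c → d′ ≡ d + 1 → Step (a , b , c , d) (a′ , b′ , c′ , d′)
  move₃₂ : a′ ≡ a → b′ ≡ b → c′ ≡ c + 1 → d′ + 2 ≡ d → Step (a , b , c , d) (a′ , b′ , c′ , d′)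
  move₃₀ : a′ ≡ a + 1 → b′ ≡ b → c′ ≡ c → d′ + 2 ≡ d → Step (a , b , c , d) (a′ , b′ , c′ , d′)

Move⇒Step : ∀ {D D′} → Move C₄ D D′ → Step (toQuad D) (toQuad D′)
Move⇒Step ((zero , zero) , (zero , suc zero) , _ , _ , _ , e₀ , e₁ , same) =
  move₀₁ e₀ e₁ (same p₂ (λ ()) (λ ())) (same p₃ (λ ()) (λ ()))
Move⇒Step ((zero , zero) , (suc zero , zero) , _ , _ , _ , e₀ , e₃ , same) =
  move₀₃ e₀ (same p₁ (λ ()) (λ ())) (same p₂ (λ ()) (λ ())) e₃
Move⇒Step ((zero , suc zero) , (zero , zero) , _ , _ , _ , e₁ , e₀ , same) =
  move₁₀ e₀ e₁ (same p₂ (λ ()) (λ ())) (same p₃ (λ ()) (λ ()))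
Move⇒Step ((zero , suc zero) , (suc zero , suc zero) , _ , _ , _ , e₁ , e₂ , same) =
  move₁₂ (same p₀ (λ ()) (λ ())) e₁ e₂ (same p₃ (λ ()) (λ ()))
Move⇒Step ((suc zero , suc zero) , (zero , suc zero) , _ , _ , _ , e₂ , e₁ , same) =
  move₂₁ (same p₀ (λ ()) (λ ())) e₁ e₂ (same p₃ (λ ()) (λ ()))
Move⇒Step ((suc zero , suc zero) , (suc zero , zero) , _ , _ , _ , e₂ , e₃ , same) =
  move₂₃ (same p₀ (λ ()) (λ ())) (same p₁ (λ ()) (λ ())) e₂ e₃
Move⇒Step ((suc zero , zero) , (suc zero , suc zero) , _ , _ , _ , e₃ , e₂ , same) =
  move₃₂ (same p₀ (λ ()) (λ ())) (same p₁ (λ ()) (λ ())) e₂ e₃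
Move⇒Step ((suc zero , zero) , (zero , zero) , _ , _ , _ , e₃ , e₀ , same) =
  move₃₀ e₀ (same p₁ (λ ()) (λ ())) (same p₂ (λ ()) (λ ())) e₃
Move⇒Step ((zero , zero) , (zero , zero) , _ , u≢w , _) = ⊥-elim (u≢w refl)
Move⇒Step ((zero , suc zero) , (zero , suc zero) , _ , u≢w , _) = ⊥-elim (u≢w refl)
Move⇒Step ((suc zero , suc zero) , (suc zero , suc zero) , _ , u≢w , _) = ⊥-elim (u≢w refl)
Move⇒Step ((suc zero , zero) , (suc zero , zero) , _ , u≢w , _) = ⊥-elim (u≢w refl)
Move⇒Step ((zero , zero) , (suc zero , suc zero) , inj₁ (_ , ()) , _)
Move⇒Step ((zero , zero) , (suc zero , suc zero) , inj₂ (() , _) , _)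
Move⇒Step ((suc zero , suc zero) , (zero , zero) , inj₁ (_ , ()) , _)
Move⇒Step ((suc zero , suc zero) , (zero , zero) , inj₂ (() , _) , _)
Move⇒Step ((zero , suc zero) , (suc zero , zero) , inj₁ (_ , ()) , _)
Move⇒Step ((zero , suc zero) , (suc zero , zero) , inj₂ (() , _) , _)
Move⇒Step ((suc zero , zero) , (zero , suc zero) , inj₁ (_ , ()) , _)
Move⇒Step ((suc zero , zero) , (zero , suc zero) , inj₂ (() , _) , _)

m+2≡n⇒2≤n : a′ + 2 ≡ a → 2 ≤ a
m+2≡n⇒2≤n {a′} refl = m≤n+m 2 a′

Step⇒Move : ∀ {x y} → Step x y → Move C₄ (fromQuad x) (fromQuad y)
Step⇒Move (move₀₁ e₀ e₁ e₂ e₃) = p₀ , p₁ , inj₂ (refl , λ ()) , (λ ()) , m+2≡n⇒2≤n e₀ , e₀ , e₁ , λ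
  { (zero , zero) ≢p₀ _ → ⊥-elim (≢p₀ refl) ; (zero , suc zero) _ ≢p₁ → ⊥-elim (≢p₁ refl)
  ; (suc zero , suc zero) _ _ → e₂ ; (suc zero , zero) _ _ → e₃ }
Step⇒Move (move₀₃ e₀ e₁ e₂ e₃) = p₀ , p₃ , inj₁ ((λ ()) , refl) , (λ ()) , m+2≡n⇒2≤n e₀ , e₀ , e₃ , λ
  { (zero , zero) ≢p₀ _ → ⊥-elim (≢p₀ refl) ; (zero , suc zero) _ _ → e₁
  ; (suc zero , suc zero) _ _ → e₂ ; (suc zero , zero) _ ≢p₃ → ⊥-elim (≢p₃ refl) }
Step⇒Move (move₁₀ e₀ e₁ e₂ e₃) = p₁ , p₀ , inj₂ (refl , λ ()) , (λ ()) , m+2≡n⇒2≤n e₁ , e₁ , e₀ , λ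
  { (zero , zero) _ ≢p₀ → ⊥-elim (≢p₀ refl) ; (zero , suc zero) ≢p₁ _ → ⊥-elim (≢p₁ refl)
  ; (suc zero , suc zero) _ _ → e₂ ; (suc zero , zero) _ _ → e₃ }
Step⇒Move (move₁₂ e₀ e₁ e₂ e₃) = p₁ , p₂ , inj₁ ((λ ()) , refl) , (λ ()) , m+2≡n⇒2≤n e₁ , e₁ , e₂ , λ
  { (zero , zero) _ _ → e₀ ; (zero , suc zero) ≢p₁ _ → ⊥-elim (≢p₁ refl)
  ; (suc zero , suc zero) _ ≢p₂ → ⊥-elim (≢p₂ refl) ; (suc zero , zero) _ _ → e₃ }
Step⇒Move (move₂₁ e₀ e₁ e₂ e₃) = p₂ , p₁ , inj₁ ((λ ()) , refl) , (λ ()) , m+2≡n⇒2≤n e₂ , e₂ , e₁ , λ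
  { (zero , zero) _ _ → e₀ ; (zero , suc zero) _ ≢p₁ → ⊥-elim (≢p₁ refl)
  ; (suc zero , suc zero) ≢p₂ _ → ⊥-elim (≢p₂ refl) ; (suc zero , zero) _ _ → e₃ }
Step⇒Move (move₂₃ e₀ e₁ e₂ e₃) = p₂ , p₃ , inj₂ (refl , λ ()) , (λ ()) , m+2≡n⇒2≤n e₂ , e₂ , e₃ , λ
  { (zero , zero) _ _ → e₀ ; (zero , suc zero) _ _ → e₁
  ; (suc zero , suc zero) ≢p₂ _ → ⊥-elim (≢p₂ refl) ; (suc zero , zero) _ ≢p₃ → ⊥-elim (≢p₃ refl) }
Step⇒Move (move₃₂ e₀ e₁ e₂ e₃) = p₃ , p₂ , inj₂ (refl , λ ()) , (λ ()) , m+2≡n⇒2≤n e₃ , e₃ , e₂ , λ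
  { (zero , zero) _ _ → e₀ ; (zero , suc zero) _ _ → e₁
  ; (suc zero , suc zero) _ ≢p₂ → ⊥-elim (≢p₂ refl) ; (suc zero , zero) ≢p₃ _ → ⊥-elim (≢p₃ refl) }
Step⇒Move (move₃₀ e₀ e₁ e₂ e₃) = p₃ , p₀ , inj₁ ((λ ()) , refl) , (λ ()) , m+2≡n⇒2≤n e₃ , e₃ , e₀ , λ
  { (zero , zero) _ ≢p₀ → ⊥-elim (≢p₀ refl) ; (zero , suc zero) _ _ → e₁
  ; (suc zero , suc zero) _ _ → e₂ ; (suc zero , zero) ≢p₃ _ → ⊥-elim (≢p₃ refl) }

Reach⇒Steps : ∀ {D D′} → Reach C₄ D D′ → Star Step (toQuad D) (toQuad D′)
Reach⇒Steps = gmap toQuad Move⇒Step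

Steps⇒Reach : ∀ {x y} → Star Step x y → Reach C₄ (fromQuad x) (fromQuad y)
Steps⇒Reach = gmap fromQuad Step⇒Move

rotate-Step : ∀ {x y} → Step x y → Step (rotate x) (rotate y)
rotate-Step (move₀₁ e₀ e₁ e₂ e₃) = move₃₀ e₁ e₂ e₃ e₀
rotate-Step (move₀₃ e₀ e₁ e₂ e₃) = move₃₂ e₁ e₂ e₃ e₀
rotate-Step (move₁₀ e₀ e₁ e₂ e₃) = move₀₃ e₁ e₂ e₃ e₀
rotate-Step (move₁₂ e₀ e₁ e₂ e₃) = move₀₁ e₁ e₂ e₃ e₀
rotate-Step (move₂₁ e₀ e₁ e₂ e₃) = move₁₀ e₁ e₂ e₃ e₀
rotate-Step (move₂₃ e₀ e₁ e₂ e₃) = move₁₂ e₁ e₂ e₃ e₀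
rotate-Step (move₃₂ e₀ e₁ e₂ e₃) = move₂₁ e₁ e₂ e₃ e₀
rotate-Step (move₃₀ e₀ e₁ e₂ e₃) = move₂₃ e₁ e₂ e₃ e₀

rotate-Steps : ∀ {x y} → Star Step x y → Star Step (rotate x) (rotate y)
rotate-Steps = gmap rotate rotate-Step

-- Lower bounds from potentials

Φ₀ Φ₁ Φ₂ Φ₃ : Quad → ℕ
Φ₀ (a , b , c , d) = 2 * a + (b + d + c / 2)
Φ₁ x = Φ₀ (rotate x)
Φ₂ x = Φ₀ (rotate (rotate x))
Φ₃ x = Φ₀ (rotate (rotate (rotate x)))

[n+2]/2≡n/2+1 : ∀ n → (n + 2) / 2 ≡ n / 2 + 1
[n+2]/2≡n/2+1 n = [m+kn]/n≡m/n+k n 1 2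

[n+1]/2≤n/2+1 : ∀ n → (n + 1) / 2 ≤ n / 2 + 1
[n+1]/2≤n/2+1 n = ≤-trans (/-monoˡ-≤ 2 (+-monoʳ-≤ n (n≤1+n 1))) (≤-reflexive ([n+2]/2≡n/2+1 n))

Φ₀-Step : ∀ {x y} → Step x y → Φ₀ y ≤ Φ₀ x
Φ₀-Step (move₀₁ {a′ = a′} {b = b} {c = c} {d = d} refl refl refl refl) =
  m+n≤o⇒m≤o _ (≤-reflexive (loses-three a′ b d (c / 2)))
  where
  loses-three : ∀ a b d h → 2 * a + (b + 1 + d + h) + 3 ≡ 2 * (a + 2) + (b + d + h)
  loses-three = solve-∀
Φ₀-Step (move₀₃ {a′ = a′} {b = b} {c = c} {d = d} refl refl refl refl) =
  m+n≤o⇒m≤o _ (≤-reflexive (loses-three a′ b d (c / 2)))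
  where
  loses-three : ∀ a b d h → 2 * a + (b + (d + 1) + h) + 3 ≡ 2 * (a + 2) + (b + d + h)
  loses-three = solve-∀
Φ₀-Step (move₁₀ {a = a} {b′ = b′} {c = c} {d = d} refl refl refl refl) = ≤-reflexive (balanced a b′ d (c / 2))
  where
  balanced : ∀ a b d h → 2 * (a + 1) + (b + d + h) ≡ 2 * a + (b + 2 + d + h)
  balanced = solve-∀
Φ₀-Step (move₃₀ {a = a} {b = b} {c = c} {d′ = d′} refl refl refl refl) = ≤-reflexive (balanced a b d′ (c / 2))
  where
  balanced : ∀ a b d h → 2 * (a + 1) + (b + d + h) ≡ 2 * a + (b + (d + 2) + h)
  balanced = solve-∀
Φ₀-Step (move₁₂ {a = a} {b′ = b′} {c = c} {d = d} refl refl refl refl) =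
  ≤-trans (+-monoʳ-≤ (2 * a) (+-monoʳ-≤ (b′ + d) ([n+1]/2≤n/2+1 c)))
          (m+n≤o⇒m≤o _ (≤-reflexive (loses-one a b′ d (c / 2))))
  where
  loses-one : ∀ a b d h → 2 * a + (b + d + (h + 1)) + 1 ≡ 2 * a + (b + 2 + d + h)
  loses-one = solve-∀
Φ₀-Step (move₃₂ {a = a} {b = b} {c = c} {d′ = d′} refl refl refl refl) =
  ≤-trans (+-monoʳ-≤ (2 * a) (+-monoʳ-≤ (b + d′) ([n+1]/2≤n/2+1 c)))
          (m+n≤o⇒m≤o _ (≤-reflexive (loses-one a b d′ (c / 2))))
  where
  loses-one : ∀ a b d h → 2 * a + (b + d + (h + 1)) + 1 ≡ 2 * a + (b + (d + 2) + h)
  loses-one = solve-∀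
Φ₀-Step (move₂₁ {a = a} {b = b} {c′ = c′} {d = d} refl refl refl refl) =
  ≤-reflexive (trans (balanced a b d (c′ / 2)) (cong (λ h → 2 * a + (b + d + h)) (sym ([n+2]/2≡n/2+1 c′))))
  where
  balanced : ∀ a b d h → 2 * a + (b + 1 + d + h) ≡ 2 * a + (b + d + (h + 1))
  balanced = solve-∀
Φ₀-Step (move₂₃ {a = a} {b = b} {c′ = c′} {d = d} refl refl refl refl) =
  ≤-reflexive (trans (balanced a b d (c′ / 2)) (cong (λ h → 2 * a + (b + d + h)) (sym ([n+2]/2≡n/2+1 c′))))
  where
  balanced : ∀ a b d h → 2 * a + (b + (d + 1) + h) ≡ 2 * a + (b + d + (h + 1))
  balanced = solve-∀

Φ₀-Steps : ∀ {x y} → Star Step x y → Φ₀ y ≤ Φ₀ x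
Φ₀-Steps = Star-antitone Φ₀ Φ₀-Step

reached≤Φ₀ : ∀ {x y} → Star Step x y → 2 * proj₁ y ≤ Φ₀ x
reached≤Φ₀ {y = a , _} steps = ≤-trans (m≤m+n (2 * a) _) (Φ₀-Steps steps)

PotentialsAtLeast : ℕ → Quad → Set
PotentialsAtLeast m x = m ≤ Φ₀ x × m ≤ Φ₁ x × m ≤ Φ₂ x × m ≤ Φ₃ x

solvable⇒potentials : ∀ {t D} → Solvable C₄ t D → PotentialsAtLeast (2 * t) (toQuad D)
solvable⇒potentials {t} {D} solvable =
  bound (λ steps → steps) (solvable p₀) ,
  bound rotate-Steps (solvable p₁) ,
  bound (λ steps → rotate-Steps (rotate-Steps steps)) (solvable p₂) ,
  bound (λ steps → rotate-Steps (rotate-Steps (rotate-Steps steps))) (solvable p₃)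
  where
  bound : ∀ {f : Quad → Quad} → (∀ {x y} → Star Step x y → Star Step (f x) (f y)) →
          (∃ λ D′ → Reach C₄ D D′ × t ≤ proj₁ (f (toQuad D′))) → 2 * t ≤ Φ₀ (f (toQuad D))
  bound f-steps (D′ , reach , t≤) = ≤-trans (*-monoʳ-≤ 2 t≤) (reached≤Φ₀ (f-steps (Reach⇒Steps reach)))

oddCount : Quad → ℕ
oddCount (a , b , c , d) = a % 2 + b % 2 + c % 2 + d % 2

potentials-sum : ∀ x → 2 * (Φ₀ x + Φ₂ x) + 2 * (Φ₁ x + Φ₃ x) + oddCount x ≡ 9 * total x
potentials-sum (a , b , c , d) =
  identity (m≡m%n+[m/n]*n a 2) (m≡m%n+[m/n]*n b 2) (m≡m%n+[m/n]*n c 2) (m≡m%n+[m/n]*n d 2)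
  where
  identity : ∀ {a b c d pa pb pc pd A B C D} →
             a ≡ pa + A * 2 → b ≡ pb + B * 2 → c ≡ pc + C * 2 → d ≡ pd + D * 2 →
             2 * ((2 * a + (b + d + C)) + (2 * c + (d + b + A))) +
             2 * ((2 * b + (c + a + D)) + (2 * d + (a + c + B))) + (pa + pb + pc + pd)
             ≡ 9 * (a + b + c + d)
  identity {pa = pa} {pb} {pc} {pd} {A} {B} {C} {D} refl refl refl refl =
    solve (pa ∷ pb ∷ pc ∷ pd ∷ A ∷ B ∷ C ∷ D ∷ [])

opposite-parity : Φ₀ (a , b , c , d) ≡ Φ₂ (a , b , c , d) → a % 2 ≡ c % 2
opposite-parity {a} {b} {c} {d} Φ₀≡Φ₂ =
  sym (remainder-unique {k = c} {k′ = a} (<-≤-trans (m%n<n c 2) (n≤1+n 2)) (<-≤-trans (m%n<n a 2) (n≤1+n 2))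
                        (+-cancelˡ-≡ (2 * Φ₀ x) _ _ doubled))
  where
  x = a , b , c , d
  identity : ∀ {a c pa pc A C} → a ≡ pa + A * 2 → c ≡ pc + C * 2 →
             2 * (2 * a + (b + d + C)) + (pc + c * 3) ≡ 2 * (2 * c + (d + b + A)) + (pa + a * 3)
  identity {pa = pa} {pc} {A} {C} refl refl = solve (pa ∷ pc ∷ A ∷ C ∷ b ∷ d ∷ [])
  -- with c = c % 2 + 2 (c / 2), doubling turns Φ₀ x ≡ Φ₂ x into a congruence modulo 3
  doubled : 2 * Φ₀ x + (c % 2 + c * 3) ≡ 2 * Φ₀ x + (a % 2 + a * 3)
  doubled = begin
    2 * Φ₀ x + (c % 2 + c * 3) ≡⟨ identity (m≡m%n+[m/n]*n a 2) (m≡m%n+[m/n]*n c 2) ⟩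
    2 * Φ₂ x + (a % 2 + a * 3) ≡⟨ cong (λ φ → 2 * φ + (a % 2 + a * 3)) Φ₀≡Φ₂ ⟨
    2 * Φ₀ x + (a % 2 + a * 3) ∎
    where open ≡-Reasoning

potentials⇒16t≤9total : ∀ {t} x → PotentialsAtLeast (2 * t) x → 16 * t ≤ 9 * total x
potentials⇒16t≤9total {t} x (h₀ , h₁ , h₂ , h₃) = begin
  16 * t                                             ≡⟨ rearrange t ⟩
  2 * (2 * t + 2 * t) + 2 * (2 * t + 2 * t)          ≤⟨ +-mono-≤ (*-monoʳ-≤ 2 (+-mono-≤ h₀ h₂))
                                                                 (*-monoʳ-≤ 2 (+-mono-≤ h₁ h₃)) ⟩
  2 * (Φ₀ x + Φ₂ x) + 2 * (Φ₁ x + Φ₃ x)              ≤⟨ m≤m+n _ (oddCount x) ⟩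
  2 * (Φ₀ x + Φ₂ x) + 2 * (Φ₁ x + Φ₃ x) + oddCount x ≡⟨ potentials-sum x ⟩
  9 * total x                                        ∎
  where
  open ≤-Reasoning
  rearrange : ∀ t → 16 * t ≡ 2 * (2 * t + 2 * t) + 2 * (2 * t + 2 * t)
  rearrange = solve-∀

C₄-16t≤9size : ∀ {t D} → Solvable C₄ t D → 16 * t ≤ 9 * size C₄ D
C₄-16t≤9size {t} {D} solvable =
  subst (λ n → 16 * t ≤ 9 * n) (sym (size≡total D)) (potentials⇒16t≤9total {t} (toQuad D) (solvable⇒potentials solvable))

C₄-lower-bound : ∀ t₀ q {D} → Solvable C₄ (t₀ + q * 9) D → 16 * q + (16 * t₀ + 8) / 9 ≤ size C₄ D
C₄-lower-bound t₀ q {D} solvable =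
  subst (_≤ size C₄ D) ceiling (m≤[1+d]*n⇒[m+d]/[1+d]≤n 8 (C₄-16t≤9size solvable))
  where
  rearrange : ∀ t₀ q → 16 * (t₀ + q * 9) + 8 ≡ 16 * t₀ + 8 + 16 * q * 9
  rearrange = solve-∀
  ceiling : (16 * (t₀ + q * 9) + 8) / 9 ≡ 16 * q + (16 * t₀ + 8) / 9
  ceiling = trans (cong (_/ 9) (rearrange t₀ q))
                  (trans ([m+kn]/n≡m/n+k (16 * t₀ + 8) (16 * q) 9) (+-comm _ (16 * q)))

[80+2k]%9≢0 : ∀ {k} → k ≤ 2 → (80 + 2 * k) % 9 ≢ 0
[80+2k]%9≢0 z≤n             = λ ()
[80+2k]%9≢0 (s≤s z≤n)       = λ ()
[80+2k]%9≢0 (s≤s (s≤s z≤n)) = λ ()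

9*n≢16*[5+q*9]+2*k : ∀ q n {k} → k ≤ 2 → 9 * n ≢ 16 * (5 + q * 9) + 2 * k
9*n≢16*[5+q*9]+2*k q n {k} k≤2 eq = [80+2k]%9≢0 k≤2 (begin
  (80 + 2 * k) % 9              ≡⟨ [m+kn]%n≡m%n (80 + 2 * k) (16 * q) 9 ⟨
  (80 + 2 * k + 16 * q * 9) % 9 ≡⟨ cong (_% 9) (rearrange q k) ⟩
  (16 * (5 + q * 9) + 2 * k) % 9 ≡⟨ cong (_% 9) eq ⟨
  9 * n % 9                     ≡⟨ cong (_% 9) (*-comm 9 n) ⟩
  n * 9 % 9                     ≡⟨ m*n%n≡0 n 9 ⟩
  0                             ∎)
  where
  open ≡-Reasoning
  rearrange : ∀ q k → 80 + 2 * k + 16 * q * 9 ≡ 16 * (5 + q * 9) + 2 * k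
  rearrange = solve-∀

potentials-tight : ∀ {m} x → PotentialsAtLeast m x → 9 * total x ≤ 2 * (m + m + (m + m)) + 1 →
                   Φ₀ x ≡ m × Φ₂ x ≡ m × Φ₁ x ≡ m × Φ₃ x ≡ m
potentials-tight {m} x (h₀ , h₁ , h₂ , h₃) 9n≤ =
  let Φ₀₂≡ , Φ₁₃≡ = squeeze (+-mono-≤ h₀ h₂) (+-mono-≤ h₁ h₃) pairs
      Φ₀≡ , Φ₂≡  = squeeze h₀ h₂ (≤-reflexive Φ₀₂≡)
      Φ₁≡ , Φ₃≡  = squeeze h₁ h₃ (≤-reflexive Φ₁₃≡)
  in  Φ₀≡ , Φ₂≡ , Φ₁≡ , Φ₃≡
  where
  open ≤-Reasoning
  pairs : Φ₀ x + Φ₂ x + (Φ₁ x + Φ₃ x) ≤ m + m + (m + m)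
  pairs = 2*m≤2*n+1⇒m≤n (begin
    2 * (Φ₀ x + Φ₂ x + (Φ₁ x + Φ₃ x))                  ≡⟨ *-distribˡ-+ 2 (Φ₀ x + Φ₂ x) _ ⟩
    2 * (Φ₀ x + Φ₂ x) + 2 * (Φ₁ x + Φ₃ x)              ≤⟨ m≤m+n _ (oddCount x) ⟩
    2 * (Φ₀ x + Φ₂ x) + 2 * (Φ₁ x + Φ₃ x) + oddCount x ≡⟨ potentials-sum x ⟩
    9 * total x                                        ≤⟨ 9n≤ ⟩
    2 * (m + m + (m + m)) + 1                          ∎)

potentials₅⇒16q+10≤total : ∀ q x → PotentialsAtLeast (2 * (5 + q * 9)) x → 16 * q + 10 ≤ total x
potentials₅⇒16q+10≤total q x@(a , b , c , d) potentials = ≮⇒≥ λ total<16q+10 →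
  let Φ₀≡ , Φ₂≡ , Φ₁≡ , Φ₃≡ = potentials-tight x potentials (9n≤ total<16q+10)
      a≡c = opposite-parity {a} {b} {c} {d} (trans Φ₀≡ (sym Φ₂≡))
      b≡d = opposite-parity {b} {c} {d} {a} (trans Φ₁≡ (sym Φ₃≡))
  in  9*n≢16*[5+q*9]+2*k q (total x) (+-mono-≤ (≤-pred (m%n<n a 2)) (≤-pred (m%n<n b 2)))
        (9n≡16t+2k (cong₂ _+_ Φ₀≡ Φ₂≡) (cong₂ _+_ Φ₁≡ Φ₃≡) a≡c b≡d)
  where
  m = 2 * (5 + q * 9)
  regroup₁ : ∀ q → 9 * (16 * q + 10) ≡ 2 * (2 * (5 + q * 9) + 2 * (5 + q * 9) + (2 * (5 + q * 9) + 2 * (5 + q * 9))) + 1 + 9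
  regroup₁ = solve-∀
  9n≤ : total x < 16 * q + 10 → 9 * total x ≤ 2 * (m + m + (m + m)) + 1
  9n≤ total<16q+10 = +-cancelʳ-≤ 9 _ _ (begin
    9 * total x + 9                 ≡⟨ trans (+-comm (9 * total x) 9) (sym (*-suc 9 (total x))) ⟩
    9 * suc (total x)               ≤⟨ *-monoʳ-≤ 9 total<16q+10 ⟩
    9 * (16 * q + 10)               ≡⟨ regroup₁ q ⟩
    2 * (m + m + (m + m)) + 1 + 9   ∎)
    where open ≤-Reasoning
  regroup₂ : ∀ q pa pb → 2 * (2 * (5 + q * 9) + 2 * (5 + q * 9)) + 2 * (2 * (5 + q * 9) + 2 * (5 + q * 9)) +
                         (pa + pb + pa + pb) ≡ 16 * (5 + q * 9) + 2 * (pa + pb)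
  regroup₂ = solve-∀
  9n≡16t+2k : Φ₀ x + Φ₂ x ≡ m + m → Φ₁ x + Φ₃ x ≡ m + m → a % 2 ≡ c % 2 → b % 2 ≡ d % 2 →
              9 * total x ≡ 16 * (5 + q * 9) + 2 * (a % 2 + b % 2)
  9n≡16t+2k Φ₀₂≡ Φ₁₃≡ a≡c b≡d = begin
    9 * total x                                                 ≡⟨ potentials-sum x ⟨
    2 * (Φ₀ x + Φ₂ x) + 2 * (Φ₁ x + Φ₃ x) + oddCount x
      ≡⟨ cong₂ (λ u w → 2 * u + 2 * w + oddCount x) Φ₀₂≡ Φ₁₃≡ ⟩
    2 * (m + m) + 2 * (m + m) + (a % 2 + b % 2 + c % 2 + d % 2)
      ≡⟨ cong₂ (λ pc pd → 2 * (m + m) + 2 * (m + m) + (a % 2 + b % 2 + pc + pd)) (sym a≡c) (sym b≡d) ⟩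
    2 * (m + m) + 2 * (m + m) + (a % 2 + b % 2 + a % 2 + b % 2) ≡⟨ regroup₂ q (a % 2) (b % 2) ⟩
    16 * (5 + q * 9) + 2 * (a % 2 + b % 2)                      ∎
    where open ≡-Reasoning

C₄-lower-bound₅ : ∀ q {D} → Solvable C₄ (5 + q * 9) D → 16 * q + 10 ≤ size C₄ D
C₄-lower-bound₅ q {D} solvable =
  subst (16 * q + 10 ≤_) (sym (size≡total D)) (potentials₅⇒16q+10≤total q (toQuad D) (solvable⇒potentials solvable))

total-rotate : ∀ x → total (rotate x) ≡ total x
total-rotate (a , b , c , d) = rearrange a b c d
  where
  rearrange : ∀ a b c d → b + c + d + a ≡ a + b + c + d
  rearrange = solve-∀

total≤2∧2≤Φ₂⇒a≤1 : total (a , b , c , d) ≤ 2 → 2 ≤ Φ₂ (a , b , c , d) → a ≤ 1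
total≤2∧2≤Φ₂⇒a≤1 {a = zero} _ _ = z≤n
total≤2∧2≤Φ₂⇒a≤1 {a = suc zero} _ _ = s≤s z≤n
total≤2∧2≤Φ₂⇒a≤1 {a = suc (suc zero)} {zero} {zero} {zero} _ (s≤s ())
total≤2∧2≤Φ₂⇒a≤1 {a = suc (suc (suc _))} (s≤s (s≤s ())) _
total≤2∧2≤Φ₂⇒a≤1 {a = suc (suc zero)} {suc _} (s≤s (s≤s ())) _
total≤2∧2≤Φ₂⇒a≤1 {a = suc (suc zero)} {zero} {suc _} (s≤s (s≤s ())) _
total≤2∧2≤Φ₂⇒a≤1 {a = suc (suc zero)} {zero} {zero} {suc _} (s≤s (s≤s ())) _

C₄-lower-bound₁ : ∀ {D} → Solvable C₄ 1 D → 3 ≤ size C₄ D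
C₄-lower-bound₁ {D} solvable with solvable⇒potentials solvable
... | h₀ , h₁ , h₂ , h₃ = ≮⇒≥ λ size<3 →
  let n≤2 = ≤-pred (subst (_< 3) (size≡total D) size<3)
  in  contradiction (≤-trans (four≤n n≤2) n≤2) λ { (s≤s (s≤s ())) }
  where
  x = toQuad D
  sparse : total x ≤ 2 → ∀ v → D v ≤ 1
  sparse n≤2 (zero , zero)         = total≤2∧2≤Φ₂⇒a≤1 n≤2 h₂
  sparse n≤2 (zero , suc zero)     = total≤2∧2≤Φ₂⇒a≤1 (subst (_≤ 2) (sym (total-rotate x)) n≤2) h₃
  sparse n≤2 (suc zero , suc zero) =
    total≤2∧2≤Φ₂⇒a≤1 (subst (_≤ 2) (sym (trans (total-rotate (rotate x)) (total-rotate x))) n≤2) h₀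
  sparse n≤2 (suc zero , zero)     =
    total≤2∧2≤Φ₂⇒a≤1 (subst (_≤ 2) (sym (trans (total-rotate (rotate (rotate x)))
                                      (trans (total-rotate (rotate x)) (total-rotate x)))) n≤2) h₁
  occupied : total x ≤ 2 → ∀ v → 1 ≤ D v
  occupied n≤2 v with solvable v
  ... | D′ , reach , 1≤D′v = subst (λ E → 1 ≤ E v) (sparse-Reach⇒≡ {C₄} (sparse n≤2) reach) 1≤D′v
  four≤n : total x ≤ 2 → 4 ≤ total x
  four≤n n≤2 =
    +-mono-≤ (+-mono-≤ (+-mono-≤ (occupied n≤2 p₀) (occupied n≤2 p₁)) (occupied n≤2 p₂)) (occupied n≤2 p₃)

-- Upper bounds by spreading and gathering

-- k pairs from p₂ go to p₁ and l pairs to p₃ (p pebbles stay), then p₁ and p₃ are emptied into p₀.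
Delivers : ℕ → Quad → Set
Delivers t (a , b , c , d) =
  ∃₂ λ k l → ∃ λ p → c ≡ k * 2 + (l * 2 + p) × t ≤ a + (b + k) / 2 + (d + l) / 2

Delivers⇒reach : ∀ {t} x → Delivers t x → ∃ λ y → Star Step x y × t ≤ proj₁ y
Delivers⇒reach (a , b , c , d) (k , l , p , refl , t≤) =
  _ , transfer (λ m n → a , n , m , d) (λ m n → move₂₁ refl (+-comm 1 n) (+-comm m 2) refl) k (l * 2 + p) b
      ◅◅ transfer (λ m n → a , b + k , m , n) (λ m n → move₂₃ refl refl (+-comm m 2) (+-comm 1 n)) l p d
      ◅◅ gather (λ m n → n , m , p , d + l) (λ m n → move₁₀ (+-comm 1 n) (+-comm m 2) refl refl) (b + k) a
      ◅◅ gather (λ m n → n , (b + k) % 2 , p , m) (λ m n → move₃₀ (+-comm 1 n) refl refl (+-comm m 2))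
                (d + l) (a + (b + k) / 2)
    , t≤

best-split : ℕ → ℕ → ℕ → ℕ
best-split b d zero    = b / 2 + d / 2
best-split b d (suc h) = best-split (suc b) d h ⊔ best-split b (suc d) h

best-split-attained : ∀ b d h → ∃₂ λ k l → k + l ≡ h × best-split b d h ≡ (b + k) / 2 + (d + l) / 2
best-split-attained b d zero =
  0 , 0 , refl , cong₂ (λ u v → u / 2 + v / 2) (sym (+-identityʳ b)) (sym (+-identityʳ d))
best-split-attained b d (suc h) with ⊔-sel (best-split (suc b) d h) (best-split b (suc d) h)
... | inj₁ eq with best-split-attained (suc b) d h
...   | k , l , k+l≡h , value =
  suc k , l , cong suc k+l≡h , trans eq (trans value (cong (λ u → u / 2 + (d + l) / 2) (sym (+-suc b k))))
best-split-attained b d (suc h) | inj₂ eq with best-split-attained b (suc d) h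
...   | k , l , k+l≡h , value =
  k , suc l , trans (+-suc k l) (cong suc k+l≡h) ,
  trans eq (trans value (cong (λ v → (b + k) / 2 + v / 2) (sym (+-suc d l))))

reach₀ : Quad → ℕ
reach₀ (a , b , c , d) = a + best-split b d (c / 2)

≤reach₀⇒Delivers : ∀ {t} x → t ≤ reach₀ x → Delivers t x
≤reach₀⇒Delivers (a , b , c , d) t≤ with best-split-attained b d (c / 2)
... | k , l , k+l≡c/2 , value =
  k , l , c % 2 , split , ≤-trans t≤ (≤-reflexive (trans (cong (a +_) value) (sym (+-assoc a _ _))))
  where
  rearrange : ∀ p k l → p + (k + l) * 2 ≡ k * 2 + (l * 2 + p)
  rearrange = solve-∀
  split : c ≡ k * 2 + (l * 2 + c % 2)
  split = trans (m≡m%n+[m/n]*n c 2) (trans (cong (λ h → c % 2 + h * 2) (sym k+l≡c/2)) (rearrange (c % 2) k l))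

raise : ℕ → Quad → Quad
raise q (a , b , c , d) = a + q * 4 , b + q * 4 , c + q * 4 , d + q * 4

Delivers-raise : ∀ {t} q x → Delivers t x → Delivers (t + q * 9) (raise q x)
Delivers-raise {t} q (a , b , c , d) (k , l , p , refl , t≤) =
  k + q * 2 , l , p , split k l p q , ≤-trans (+-monoˡ-≤ (q * 9) t≤) (≤-reflexive (sym gain))
  where
  split : ∀ k l p q → k * 2 + (l * 2 + p) + q * 4 ≡ (k + q * 2) * 2 + (l * 2 + p)
  split = solve-∀
  regroup₁ : ∀ b k q → b + q * 4 + (k + q * 2) ≡ b + k + q * 3 * 2
  regroup₁ = solve-∀
  regroup₂ : ∀ d l q → d + q * 4 + l ≡ d + l + q * 2 * 2
  regroup₂ = solve-∀
  regroup₃ : ∀ a u v q → a + q * 4 + (u + q * 3) + (v + q * 2) ≡ a + u + v + q * 9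
  regroup₃ = solve-∀
  gain : a + q * 4 + (b + q * 4 + (k + q * 2)) / 2 + (d + q * 4 + l) / 2 ≡ a + (b + k) / 2 + (d + l) / 2 + q * 9
  gain = begin
    a + q * 4 + (b + q * 4 + (k + q * 2)) / 2 + (d + q * 4 + l) / 2
      ≡⟨ cong₂ (λ u v → a + q * 4 + u / 2 + v / 2) (regroup₁ b k q) (regroup₂ d l q) ⟩
    a + q * 4 + (b + k + q * 3 * 2) / 2 + (d + l + q * 2 * 2) / 2
      ≡⟨ cong₂ (λ u v → a + q * 4 + u + v) ([m+kn]/n≡m/n+k (b + k) (q * 3) 2) ([m+kn]/n≡m/n+k (d + l) (q * 2) 2) ⟩
    a + q * 4 + ((b + k) / 2 + q * 3) + ((d + l) / 2 + q * 2)
      ≡⟨ regroup₃ a ((b + k) / 2) ((d + l) / 2) q ⟩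
    a + (b + k) / 2 + (d + l) / 2 + q * 9 ∎
    where open ≡-Reasoning

Solves : ℕ → Quad → Set
Solves t x = Delivers t x × Delivers t (rotate x) × Delivers t (rotate (rotate x)) ×
             Delivers t (rotate (rotate (rotate x)))

guarantee : Quad → ℕ
guarantee x = reach₀ x ⊓ reach₀ (rotate x) ⊓ reach₀ (rotate (rotate x)) ⊓ reach₀ (rotate (rotate (rotate x)))

≤guarantee⇒Solves : ∀ {t} x → t ≤ guarantee x → Solves t x
≤guarantee⇒Solves x t≤ =
  ≤reach₀⇒Delivers x (≤-trans t≤ (≤-trans (m⊓n≤m _ _) (≤-trans (m⊓n≤m _ _) (m⊓n≤m _ _)))) ,
  ≤reach₀⇒Delivers (rotate x) (≤-trans t≤ (≤-trans (m⊓n≤m _ _) (≤-trans (m⊓n≤m _ _) (m⊓n≤n _ _)))) ,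
  ≤reach₀⇒Delivers (rotate (rotate x)) (≤-trans t≤ (≤-trans (m⊓n≤m _ _) (m⊓n≤n _ _))) ,
  ≤reach₀⇒Delivers (rotate (rotate (rotate x))) (≤-trans t≤ (m⊓n≤n _ _))

Solves-raise : ∀ {t} q x → Solves t x → Solves (t + q * 9) (raise q x)
Solves-raise q x (δ₀ , δ₁ , δ₂ , δ₃) =
  Delivers-raise q x δ₀ , Delivers-raise q (rotate x) δ₁ ,
  Delivers-raise q (rotate (rotate x)) δ₂ , Delivers-raise q (rotate (rotate (rotate x))) δ₃

Solves⇒Solvable : ∀ {t} x → Solves t x → Solvable C₄ t (fromQuad x)
Solves⇒Solvable x (δ₀ , _ , _ , _) (zero , zero) with Delivers⇒reach x δ₀
... | y , steps , t≤ = fromQuad y , Steps⇒Reach steps , t≤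
Solves⇒Solvable x (_ , δ₁ , _ , _) (zero , suc zero) with Delivers⇒reach (rotate x) δ₁
... | y , steps , t≤ =
  fromQuad (rotate (rotate (rotate y))) , Steps⇒Reach (rotate-Steps (rotate-Steps (rotate-Steps steps))) , t≤
Solves⇒Solvable x (_ , _ , δ₂ , _) (suc zero , suc zero) with Delivers⇒reach (rotate (rotate x)) δ₂
... | y , steps , t≤ = fromQuad (rotate (rotate y)) , Steps⇒Reach (rotate-Steps (rotate-Steps steps)) , t≤
Solves⇒Solvable x (_ , _ , _ , δ₃) (suc zero , zero) with Delivers⇒reach (rotate (rotate (rotate x))) δ₃
... | y , steps , t≤ = fromQuad (rotate y) , Steps⇒Reach (rotate-Steps steps) , t≤

size-raise : ∀ q x → size C₄ (fromQuad (raise q x)) ≡ 16 * q + total x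
size-raise q (a , b , c , d) = rearrange q a b c d
  where
  rearrange : ∀ q a b c d →
              a + q * 4 + (b + q * 4 + (d + q * 4 + (c + q * 4 + 0))) ≡ 16 * q + (a + b + c + d)
  rearrange = solve-∀

C₄-optimal : ∀ t₀ q x → t₀ ≤ guarantee x →
             (∀ {D} → Solvable C₄ (t₀ + q * 9) D → 16 * q + total x ≤ size C₄ D) →
             IsOptimalPebbling C₄ (t₀ + q * 9) (16 * q + total x)
C₄-optimal t₀ q x t₀≤ lower =
  (fromQuad (raise q x) , Solves⇒Solvable (raise q x) (Solves-raise q x (≤guarantee⇒Solves x t₀≤)) , size-raise q x) ,
  λ D → lower

C₄-optimal₀ : ∀ q → IsOptimalPebbling C₄ (0 + q * 9) (16 * q + 0)
C₄-optimal₀ q = C₄-optimal 0 q (0 , 0 , 0 , 0) ≤-compute (C₄-lower-bound 0 q)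

C₄-optimal₁ : IsOptimalPebbling C₄ 1 3
C₄-optimal₁ = C₄-optimal 1 0 (0 , 0 , 1 , 2) ≤-compute C₄-lower-bound₁

C₄-optimal₂ : ∀ q → IsOptimalPebbling C₄ (2 + q * 9) (16 * q + 4)
C₄-optimal₂ q = C₄-optimal 2 q (0 , 2 , 0 , 2) ≤-compute (C₄-lower-bound 2 q)

C₄-optimal₃ : ∀ q → IsOptimalPebbling C₄ (3 + q * 9) (16 * q + 6)
C₄-optimal₃ q = C₄-optimal 3 q (0 , 2 , 0 , 4) ≤-compute (C₄-lower-bound 3 q)

C₄-optimal₄ : ∀ q → IsOptimalPebbling C₄ (4 + q * 9) (16 * q + 8)
C₄-optimal₄ q = C₄-optimal 4 q (0 , 4 , 0 , 4) ≤-compute (C₄-lower-bound 4 q)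

C₄-optimal₅ : ∀ q → IsOptimalPebbling C₄ (5 + q * 9) (16 * q + 10)
C₄-optimal₅ q = C₄-optimal 5 q (0 , 4 , 0 , 6) ≤-compute (C₄-lower-bound₅ q)

C₄-optimal₆ : ∀ q → IsOptimalPebbling C₄ (6 + q * 9) (16 * q + 11)
C₄-optimal₆ q = C₄-optimal 6 q (2 , 3 , 2 , 4) ≤-compute (C₄-lower-bound 6 q)

C₄-optimal₇ : ∀ q → IsOptimalPebbling C₄ (7 + q * 9) (16 * q + 13)
C₄-optimal₇ q = C₄-optimal 7 q (2 , 4 , 2 , 5) ≤-compute (C₄-lower-bound 7 q)

C₄-optimal₈ : ∀ q → IsOptimalPebbling C₄ (8 + q * 9) (16 * q + 15)
C₄-optimal₈ q = C₄-optimal 8 q (2 , 5 , 2 , 6) ≤-compute (C₄-lower-bound 8 q)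

-- The base (0 , 0 , 1 , 2) of t = 1 is one pebble too large to serve the other t ≡ 1 (mod 9).
C₄-optimal₁₀ : ∀ q → IsOptimalPebbling C₄ (10 + q * 9) (16 * q + 18)
C₄-optimal₁₀ q = C₄-optimal 10 q (4 , 5 , 4 , 5) ≤-compute (C₄-lower-bound 10 q)

-- Optimal pebbling of K₂

pair : ℕ → ℕ → Distribution K₂
pair x y zero       = x
pair x y (suc zero) = y

K₂-pass₁₀ : ∀ m n → Move K₂ (pair n (2 + m)) (pair (1 + n) m)
K₂-pass₁₀ m n = suc zero , zero , (λ ()) , (λ ()) , s≤s (s≤s z≤n) , +-comm m 2 , +-comm 1 n ,
  λ { zero _ ≢0 → ⊥-elim (≢0 refl) ; (suc zero) ≢1 _ → ⊥-elim (≢1 refl) }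

K₂-pass₀₁ : ∀ m n → Move K₂ (pair (2 + m) n) (pair m (1 + n))
K₂-pass₀₁ m n = zero , suc zero , (λ ()) , (λ ()) , s≤s (s≤s z≤n) , +-comm m 2 , +-comm 1 n ,
  λ { zero ≢0 _ → ⊥-elim (≢0 refl) ; (suc zero) _ ≢1 → ⊥-elim (≢1 refl) }

K₂-solvable : ∀ {n x y} → n ≤ x + y / 2 → n ≤ y + x / 2 → Solvable K₂ n (pair x y)
K₂-solvable {x = x} {y} n≤₀ n≤₁ zero       = _ , gather (λ m n → pair n m) K₂-pass₁₀ y x , n≤₀
K₂-solvable {x = x} {y} n≤₀ n≤₁ (suc zero) = _ , gather pair K₂-pass₀₁ x y , n≤₁

K₂-raised : ∀ {s} α β m → s ≤ α + β / 2 → s ≤ β + α / 2 → α + β ≡ (4 * s + 2) / 3 →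
            ∃ λ D → Solvable K₂ (s + m * 3) D × size K₂ D ≡ (4 * (s + m * 3) + 2) / 3
K₂-raised {s} α β m s≤₀ s≤₁ α+β≡ =
  pair (α + m * 2) (β + m * 2) , K₂-solvable (bound α β s≤₀) (bound β α s≤₁) , size≡
  where
  regroup₁ : ∀ u w m → u + m * 2 + (w + m) ≡ u + w + m * 3
  regroup₁ = solve-∀
  bound : ∀ u v → s ≤ u + v / 2 → s + m * 3 ≤ u + m * 2 + (v + m * 2) / 2
  bound u v s≤ = ≤-trans (+-monoˡ-≤ (m * 3) s≤)
    (≤-reflexive (sym (trans (cong (u + m * 2 +_) ([m+kn]/n≡m/n+k v m 2)) (regroup₁ u (v / 2) m))))
  regroup₂ : ∀ α β m → α + m * 2 + (β + m * 2 + 0) ≡ α + β + m * 4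
  regroup₂ = solve-∀
  regroup₃ : ∀ s m → 4 * s + 2 + m * 4 * 3 ≡ 4 * (s + m * 3) + 2
  regroup₃ = solve-∀
  size≡ : α + m * 2 + (β + m * 2 + 0) ≡ (4 * (s + m * 3) + 2) / 3
  size≡ = begin
    α + m * 2 + (β + m * 2 + 0)     ≡⟨ regroup₂ α β m ⟩
    α + β + m * 4                   ≡⟨ cong (_+ m * 4) α+β≡ ⟩
    (4 * s + 2) / 3 + m * 4         ≡⟨ [m+kn]/n≡m/n+k (4 * s + 2) (m * 4) 3 ⟨
    (4 * s + 2 + m * 4 * 3) / 3     ≡⟨ cong (_/ 3) (regroup₃ s m) ⟩
    (4 * (s + m * 3) + 2) / 3       ∎
    where open ≡-Reasoning

K₂-upper : ∀ n → ∃ λ D → Solvable K₂ n D × size K₂ D ≡ (4 * n + 2) / 3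
K₂-upper n with n % 3 | n / 3 | m≡m%n+[m/n]*n n 3 | m%n<n n 3
... | 0                 | m | refl | _ = K₂-raised 0 0 m ≤-compute ≤-compute refl
... | 1                 | m | refl | _ = K₂-raised 1 1 m ≤-compute ≤-compute refl
... | 2                 | m | refl | _ = K₂-raised 2 1 m ≤-compute ≤-compute refl
... | suc (suc (suc _)) | _ | _    | s≤s (s≤s (s≤s ()))

K₂-potential : ∀ v {D D′} → Move K₂ D D′ → D′ v + size K₂ D′ ≤ D v + size K₂ D
K₂-potential _ (zero , zero , _ , u≢w , _) = ⊥-elim (u≢w refl)
K₂-potential _ (suc zero , suc zero , _ , u≢w , _) = ⊥-elim (u≢w refl)
K₂-potential zero {D} {D′} (zero , suc zero , _ , _ , _ , e₀ , e₁ , _) rewrite sym e₀ | e₁ =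
  m+n≤o⇒m≤o _ (≤-reflexive (loses-three (D′ zero) (D (suc zero))))
  where
  loses-three : ∀ x y → x + (x + (y + 1 + 0)) + 3 ≡ x + 2 + (x + 2 + (y + 0))
  loses-three = solve-∀
K₂-potential (suc zero) {D} {D′} (zero , suc zero , _ , _ , _ , e₀ , e₁ , _) rewrite sym e₀ | e₁ =
  ≤-reflexive (balanced (D′ zero) (D (suc zero)))
  where
  balanced : ∀ x y → y + 1 + (x + (y + 1 + 0)) ≡ y + (x + 2 + (y + 0))
  balanced = solve-∀
K₂-potential zero {D} {D′} (suc zero , zero , _ , _ , _ , e₁ , e₀ , _) rewrite sym e₁ | e₀ =
  ≤-reflexive (balanced (D zero) (D′ (suc zero)))
  where
  balanced : ∀ x y → x + 1 + (x + 1 + (y + 0)) ≡ x + (x + (y + 2 + 0))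
  balanced = solve-∀
K₂-potential (suc zero) {D} {D′} (suc zero , zero , _ , _ , _ , e₁ , e₀ , _) rewrite sym e₁ | e₀ =
  m+n≤o⇒m≤o _ (≤-reflexive (loses-three (D zero) (D′ (suc zero))))
  where
  loses-three : ∀ x y → y + (x + 1 + (y + 0)) + 3 ≡ y + 2 + (x + (y + 2 + 0))
  loses-three = solve-∀

K₂-vertex≤size : ∀ D v → D v ≤ size K₂ D
K₂-vertex≤size D zero       = m≤m+n (D zero) _
K₂-vertex≤size D (suc zero) = ≤-trans (m≤m+n (D (suc zero)) 0) (m≤n+m _ (D zero))

K₂-4n≤3size : ∀ {n D} → Solvable K₂ n D → 4 * n ≤ 3 * size K₂ D
K₂-4n≤3size {n} {D} solvable = begin
  4 * n                                                ≡⟨ double n ⟩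
  2 * n + 2 * n                                        ≤⟨ +-mono-≤ (at zero) (at (suc zero)) ⟩
  (D zero + size K₂ D) + (D (suc zero) + size K₂ D)    ≡⟨ regroup (D zero) (D (suc zero)) ⟩
  3 * size K₂ D                                        ∎
  where
  open ≤-Reasoning
  double : ∀ n → 4 * n ≡ 2 * n + 2 * n
  double = solve-∀
  regroup : ∀ x y → x + (x + (y + 0)) + (y + (x + (y + 0))) ≡ 3 * (x + (y + 0))
  regroup = solve-∀
  at : ∀ v → 2 * n ≤ D v + size K₂ D
  at v with solvable v
  ... | D′ , reach , n≤D′v =
    ≤-trans (+-mono-≤ n≤D′v (≤-trans (≤-reflexive (+-identityʳ n)) (≤-trans n≤D′v (K₂-vertex≤size D′ v))))
            (Star-antitone (λ E → E v + size K₂ E) (K₂-potential v) reach)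

K₂-optimal : ∀ n → IsOptimalPebbling K₂ n ((4 * n + 2) / 3)
K₂-optimal n = K₂-upper n , λ D solvable → m≤[1+d]*n⇒[m+d]/[1+d]≤n 2 (K₂-4n≤3size solvable)

K₂-to-C₄ : ∀ q r → (2 * ((4 * (2 * (r + q * 9)) + 2) / 3) + 2) / 3 ≡ 16 * q + (2 * ((8 * r + 2) / 3) + 2) / 3
K₂-to-C₄ q r = begin
  (2 * ((4 * (2 * (r + q * 9)) + 2) / 3) + 2) / 3  ≡⟨ cong (λ n → (2 * (n / 3) + 2) / 3) (regroup₁ q r) ⟩
  (2 * ((8 * r + 2 + q * 24 * 3) / 3) + 2) / 3     ≡⟨ cong (λ n → (2 * n + 2) / 3) ([m+kn]/n≡m/n+k (8 * r + 2) (q * 24) 3) ⟩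
  (2 * ((8 * r + 2) / 3 + q * 24) + 2) / 3         ≡⟨ cong (_/ 3) (regroup₂ ((8 * r + 2) / 3) q) ⟩
  (2 * ((8 * r + 2) / 3) + 2 + q * 16 * 3) / 3     ≡⟨ [m+kn]/n≡m/n+k (2 * ((8 * r + 2) / 3) + 2) (q * 16) 3 ⟩
  (2 * ((8 * r + 2) / 3) + 2) / 3 + q * 16         ≡⟨ +-comm _ (q * 16) ⟩
  q * 16 + (2 * ((8 * r + 2) / 3) + 2) / 3         ≡⟨ cong (_+ ((2 * ((8 * r + 2) / 3) + 2) / 3)) (*-comm q 16) ⟩
  16 * q + (2 * ((8 * r + 2) / 3) + 2) / 3         ∎
  where
  open ≡-Reasoning
  regroup₁ : ∀ q r → 4 * (2 * (r + q * 9)) + 2 ≡ 8 * r + 2 + q * 24 * 3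
  regroup₁ = solve-∀
  regroup₂ : ∀ a q → 2 * (a + q * 24) + 2 ≡ 2 * a + 2 + q * 16 * 3
  regroup₂ = solve-∀

Proposition-at : ℕ → ℕ → Set
Proposition-at q r =
  (r + q * 9 ≡ 1 → IsOptimalPebbling C₄ (r + q * 9) 3) ×
  (r ≤ 5 → r + q * 9 ≢ 1 → IsOptimalPebbling C₄ (r + q * 9) (16 * q + 2 * r)) ×
  (6 ≤ r → IsOptimalPebbling C₄ (r + q * 9) (16 * q + 2 * r ∸ 1)) ×
  (r + q * 9 ≢ 1 → ∃ λ a → IsOptimalPebbling K₂ (2 * (r + q * 9)) a ×
                           IsOptimalPebbling C₄ (r + q * 9) ((2 * a + 2) / 3))

residue≤5 : ∀ q r → r ≤ 5 → r + q * 9 ≢ 1 → (2 * ((8 * r + 2) / 3) + 2) / 3 ≡ 2 * r →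
            IsOptimalPebbling C₄ (r + q * 9) (16 * q + 2 * r) → Proposition-at q r
residue≤5 q r r≤5 t≢1 value optimal =
  (λ t≡1 → ⊥-elim (t≢1 t≡1)) ,
  (λ _ _ → optimal) ,
  (λ 6≤r → ⊥-elim (<⇒≱ (s≤s r≤5) 6≤r)) ,
  λ _ → _ , K₂-optimal (2 * (r + q * 9)) ,
        subst (IsOptimalPebbling C₄ (r + q * 9)) (sym (trans (K₂-to-C₄ q r) (cong (16 * q +_) value))) optimal

residue≥6 : ∀ q r → 6 ≤ r → (2 * ((8 * r + 2) / 3) + 2) / 3 ≡ 2 * r ∸ 1 →
            IsOptimalPebbling C₄ (r + q * 9) (16 * q + (2 * r ∸ 1)) → Proposition-at q r
residue≥6 q r 6≤r value optimal =
  (λ t≡1 → contradiction (subst (6 ≤_) t≡1 (≤-trans 6≤r (m≤m+n r (q * 9)))) λ { (s≤s ()) }) ,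
  (λ r≤5 → ⊥-elim (<⇒≱ (s≤s r≤5) 6≤r)) ,
  (λ _ → subst (IsOptimalPebbling C₄ (r + q * 9)) (sym (+-∸-assoc (16 * q) 1≤2r)) optimal) ,
  λ _ → _ , K₂-optimal (2 * (r + q * 9)) ,
        subst (IsOptimalPebbling C₄ (r + q * 9)) (sym (trans (K₂-to-C₄ q r) (cong (16 * q +_) value))) optimal
  where
  1≤2r : 1 ≤ 2 * r
  1≤2r = ≤-trans (≤-trans (s≤s z≤n) 6≤r) (m≤m+n r _)

residue-of-1 : Proposition-at 0 1
residue-of-1 =
  (λ _ → C₄-optimal₁) , (λ _ t≢1 → ⊥-elim (t≢1 refl)) , (λ { (s≤s ()) }) , λ t≢1 → ⊥-elim (t≢1 refl)

by-residue : ∀ q r → r < 9 → 1 ≤ r + q * 9 → Proposition-at q r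
by-residue zero    0 _ ()
by-residue (suc q) 0 _ _ = residue≤5 (suc q) 0 z≤n (λ ()) refl (C₄-optimal₀ (suc q))
by-residue zero    1 _ _ = residue-of-1
by-residue (suc q) 1 _ _ =
  residue≤5 (suc q) 1 ≤-compute (λ ()) refl (subst (IsOptimalPebbling C₄ (10 + q * 9)) (regroup q) (C₄-optimal₁₀ q))
  where
  regroup : ∀ q → 16 * q + 18 ≡ 16 * suc q + 2 * 1
  regroup = solve-∀
by-residue q 2 _ _ = residue≤5 q 2 ≤-compute (λ ()) refl (C₄-optimal₂ q)
by-residue q 3 _ _ = residue≤5 q 3 ≤-compute (λ ()) refl (C₄-optimal₃ q)
by-residue q 4 _ _ = residue≤5 q 4 ≤-compute (λ ()) refl (C₄-optimal₄ q)
by-residue q 5 _ _ = residue≤5 q 5 ≤-compute (λ ()) refl (C₄-optimal₅ q)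
by-residue q 6 _ _ = residue≥6 q 6 ≤-compute refl (C₄-optimal₆ q)
by-residue q 7 _ _ = residue≥6 q 7 ≤-compute refl (C₄-optimal₇ q)
by-residue q 8 _ _ = residue≥6 q 8 ≤-compute refl (C₄-optimal₈ q)
by-residue q (suc (suc (suc (suc (suc (suc (suc (suc (suc r))))))))) r<9 _ = ⊥-elim (≤⇒≯ (m≤m+n 9 r) r<9)

proposition3p12 : ∀ (t : ℕ) → 1 ≤ t →
    (t ≡ 1 → IsOptimalPebbling (K₂ □ K₂) t 3) ×
    (t % 9 ≤ 5 → t ≢ 1 → IsOptimalPebbling (K₂ □ K₂) t (16 * (t / 9) + 2 * (t % 9))) ×
    (6 ≤ t % 9 → IsOptimalPebbling (K₂ □ K₂) t (16 * (t / 9) + 2 * (t % 9) ∸ 1)) ×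
    (t ≢ 1 → ∃ λ a → IsOptimalPebbling K₂ (2 * t) a ×
                     IsOptimalPebbling (K₂ □ K₂) t ((2 * a + 2) / 3))
proposition3p12 t 1≤t with t / 9 | t % 9 | m≡m%n+[m/n]*n t 9 | m%n<n t 9
... | q | r | refl | r<9 = by-residue q r r<9 1≤t
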